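{- Let $F$ be a bipartite graph that contains a cycle. If $F$ contains a critical vertex $v$ such that the graph $F-v$ (obtained from $F$ by deleting $v$ and all edges incident to it) is connected, then $F$ is bounded.
   Context: For a graph $G$ on $n$ vertices, $\Delta(G)$ is its maximum degree and $\mathrm{ex}(n,F)$ is the maximum number of edges in an $n$-vertex graph containing no copy of $F$. A graph $F$ is $(\alpha,\beta)$-bounded (for reals $\alpha,\beta>0$) if there exists $N_0$ such that every graph $G$ on $n\ge N_0$ vertices with $\Delta(G)\ge \alpha (n-1)$ and $|E(G)|\ge (1-\beta)\,\mathrm{ex}(n,F)$ contains a copy of $F$. $F$ is bounded if it is $(\alpha,\beta)$-bounded for some constants $0<\alpha,\beta<1$. A bipartition $V(F)=V_1\cup V_2$ of a bipartite graph $F$ is proper if every edge of $F$ meets both $V_1$ and $V_2$; $F[V_1,V_2]$ denotes $F$ together with this ordered bipartition. For $v\in V_1$ (resp. $v\in V_2$), $F[V_1,V_2]-v$ denotes the graph $F-v$ with ordered bipartition $(V_1\setminus\{v\},V_2)$ (resp. $(V_1,V_2\setminus\{v\})$). A bipartite graph $G$ with ordered bipartition $(U_1,U_2)$ is ordered-$F[V_1,V_2]$-free if there is no copy of $F$ in $G$ with $V_1$ mapped into $U_1$ and $V_2$ mapped into $U_2$. The Zarankiewicz number $Z(m,n,F[V_1,V_2])$ is the maximum number of edges in an ordered-$F[V_1,V_2]$-free bipartite graph with ordered bipartition $(U_1,U_2)$, $|U_1|=m$, $|U_2|=n$. A vertex $v$ of a bipartite graph $F$ is critical if there is a proper bipartition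 $V(F)=V_1\cup V_2$ such that $\lim_{n\to\infty} Z(n,n,F[V_1,V_2]-v)/\mathrm{ex}(n,F)=0$. -}

module Defs where

open import Data.Nat as ℕ using (ℕ; zero; suc; _+_; _∸_; _⊔_)
open import Data.Bool using (Bool; true; false; if_then_else_; _∧_)
open import Data.Fin as Fin using (Fin; zero; suc; toℕ; punchIn; inject₁; fromℕ)
open import Data.Fin.Properties using () renaming (_<?_ to _<ᶠ?_)
open import Data.List using (List; foldr; map)
open import Data.List using () renaming (allFin to allFinL)
open import Data.Sum using (_⊎_; inj₁; inj₂)
open import Data.Product using (Σ; ∃; ∃-syntax; _×_; _,_)
open import Data.Integer using (+_)
open import Data.Rational using (ℚ; _/_; _<_; _≤_; _*_; _-_; 0ℚ; 1ℚ)
open import Relation.Nullary using (¬_)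
open import Relation.Nullary.Decidable using (⌊_⌋)
open import Relation.Binary.PropositionalEquality using (_≡_; _≢_)
open import Function.Definitions using (Injective)

toℚ : ℕ → ℚ
toℚ n = + n / 1

record Graph (n : ℕ) : Set where
  field
    adj    : Fin n → Fin n → Bool
    sym    : ∀ i j → adj i j ≡ adj j i
    irrefl : ∀ i → adj i i ≡ false
open Graph public

count : ∀ {n} → (Fin n → Bool) → ℕ
count {zero}  f = 0
count {suc n} f = (if f zero then 1 else 0) + count (λ i → f (suc i))

sumFin : ∀ {n} → (Fin n → ℕ) → ℕ
sumFin {zero}  f = 0
sumFin {suc n} f = f zero + sumFin (λ i → f (suc i))

degree : ∀ {n} → Graph n → Fin n → ℕ
degree G x = count (adj G x)

-- maximum degree Δ(G) (0 for the empty graph)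
maxDegree : ∀ {n} → Graph n → ℕ
maxDegree {n} G = foldr _⊔_ 0 (map (degree G) (allFinL n))

edges : ∀ {n} → Graph n → ℕ
edges G = sumFin (λ i → count (λ j → adj G i j ∧ ⌊ i <ᶠ? j ⌋))

Contains : ∀ {n k} → Graph n → Graph k → Set
Contains G F = Σ (Fin _ → Fin _) λ f → Injective _≡_ _≡_ f ×
  (∀ x y → adj F x y ≡ true → adj G (f x) (f y) ≡ true)

IsEx : ∀ {k} → ℕ → Graph k → ℕ → Set
IsEx n F e =
  (Σ (Graph n) λ G → ¬ Contains G F × edges G ≡ e) ×
  (∀ (G : Graph n) → ¬ Contains G F → edges G ℕ.≤ e)

HasCycle : ∀ {k} → Graph k → Set
HasCycle {k} F = ∃[ l ] Σ (Fin (3 + l) → Fin k) λ c → Injective _≡_ _≡_ c ×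
  (∀ (i : Fin (2 + l)) → adj F (c (inject₁ i)) (c (suc i)) ≡ true) ×
  (adj F (c (fromℕ (2 + l))) (c zero) ≡ true)

-- a bipartition, given by the side of each vertex (true = V₁, false = V₂)
Bipartition : ℕ → Set
Bipartition k = Fin k → Bool

Proper : ∀ {k} → Graph k → Bipartition k → Set
Proper F part = ∀ x y → adj F x y ≡ true → part x ≢ part y

IsBipartite : ∀ {k} → Graph k → Set
IsBipartite {k} F = Σ (Bipartition k) (Proper F)

data Reach {n} (G : Graph n) : Fin n → Fin n → Set where
  here : ∀ {x} → Reach G x x
  step : ∀ {x y z} → adj G x y ≡ true → Reach G y z → Reach G x z

Connected : ∀ {n} → Graph n → Set
Connected G = ∀ x y → Reach G x y

delete : ∀ {k} → Graph (suc k) → Fin (suc k) → Graph k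
delete F v = record
  { adj    = λ i j → adj F (punchIn v i) (punchIn v j)
  ; sym    = λ i j → sym F (punchIn v i) (punchIn v j)
  ; irrefl = λ i → irrefl F (punchIn v i) }

-- bipartite graph with ordered bipartition (U₁,U₂), |U₁| = m, |U₂| = n
BGraph : ℕ → ℕ → Set
BGraph m n = Fin m → Fin n → Bool

bedges : ∀ {m n} → BGraph m n → ℕ
bedges B = sumFin (λ a → count (λ b → B a b))

badj : ∀ {m n} → BGraph m n → Fin m ⊎ Fin n → Fin m ⊎ Fin n → Bool
badj B (inj₁ a) (inj₂ b) = B a b
badj B (inj₂ b) (inj₁ a) = B a b
badj B _ _ = false

side : ∀ {m n} → Fin m ⊎ Fin n → Bool
side (inj₁ _) = true
side (inj₂ _) = false

-- B contains an ordered copy of F[V₁,V₂] (V₁ into U₁, V₂ into U₂)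
OrdContains : ∀ {m n k} → BGraph m n → Graph k → Bipartition k → Set
OrdContains {m} {n} {k} B F part =
  Σ (Fin k → Fin m ⊎ Fin n) λ f → Injective _≡_ _≡_ f ×
  (∀ x → side (f x) ≡ part x) ×
  (∀ x y → adj F x y ≡ true → badj B (f x) (f y) ≡ true)

IsZ : ∀ {k} → ℕ → ℕ → Graph k → Bipartition k → ℕ → Set
IsZ m n F part z =
  (Σ (BGraph m n) λ B → ¬ OrdContains B F part × bedges B ≡ z) ×
  (∀ (B : BGraph m n) → ¬ OrdContains B F part → bedges B ℕ.≤ z)

Critical : ∀ {k} → Graph (suc k) → Fin (suc k) → Set
Critical {k} F v = Σ (Bipartition (suc k)) λ part → Proper F part ×
  (∀ (ε : ℚ) → 0ℚ < ε → ∃[ N ] ∀ n → N ℕ.≤ n → ∀ z e →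
     IsZ n n (delete F v) (λ i → part (punchIn v i)) z → IsEx n F e →
     toℚ z < ε * toℚ e)

BoundedWith : ∀ {k} → ℚ → ℚ → Graph k → Set
BoundedWith α β F = ∃[ N₀ ] ∀ n → N₀ ℕ.≤ n → ∀ (G : Graph n) →
  α * toℚ (n ∸ 1) ≤ toℚ (maxDegree G) →
  ∀ e → IsEx n F e → (1ℚ - β) * toℚ e ≤ toℚ (edges G) →
  Contains G F

Bounded : ∀ {k} → Graph k → Set
Bounded F = ∃[ α ] ∃[ β ] (0ℚ < α × α < 1ℚ × 0ℚ < β × β < 1ℚ × BoundedWith α β F)

-- Take α = 2/3, β = 1/4, and let G be an F-free graph on n vertices with Δ(G) ≥ 2(n − 1)/3 and
-- e(G) ≥ (3/4) ex(n, F). Let x be a vertex of maximum degree, N its neighbourhood and R the rest,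
-- so that |R| ≤ n/2. As x is adjacent to all of N, an ordered copy of F − v between R ∖ {x} and N,
-- or across a maximum cut of G[N], extends to a copy of F by sending v to x. Hence e(R, N) ≤ n + Z
-- and e(G[N]) ≤ 2Z, where Z = Z(n, n, F[V₁,V₂] − v). Since F − v is connected, two disjoint copies of
-- G[R] padded with isolated vertices form an F-free graph on n vertices, so 2 e(G[R]) ≤ ex(n, F).
-- A perfect matching contains no path on three vertices, so n ≤ Z, and altogether
-- 2 e(G) ≤ ex(n, F) + 8Z. With e(G) ≥ (3/4) ex(n, F) this gives ex(n, F) ≤ 16 Z, which criticality of v
-- rules out for large n. Containment is decidable, so G does contain F.
module Submission where

open import Defs
open import Algebra.Bundles using (CommutativeMonoid)
open import Data.Bool as Bool using (Bool; true; false; if_then_else_; _∧_; not; _xor_)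
open import Data.Bool.Properties using (∧-assoc; ∧-comm; ∧-zeroʳ; ∧-identityʳ; ∧-commutativeMonoid; xor-comm)
open import Algebra.Properties.CommutativeSemigroup (CommutativeMonoid.commutativeSemigroup ∧-commutativeMonoid)
  using (xy∙z≈xz∙y) renaming (interchange to ∧-interchange)
open import Data.Empty using (⊥; ⊥-elim)
open import Data.Fin as Fin using (Fin; zero; suc; _≟_; _<?_; _↑ˡ_; _↑ʳ_; splitAt; join; punchIn; punchOut)
open import Data.Fin.Properties
  using (toℕ-injective; suc-injective; splitAt-↑ˡ; splitAt-↑ʳ; join-splitAt; punchIn-punchOut; punchOut-injective;
         any?; all?; injective⇒≤)
import Data.Integer as ℤ
import Data.Integer.Properties as ℤ
open import Data.List as List using ([]; _∷_; foldr; map)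
open import Data.Maybe as Maybe using (Maybe; just; nothing)
open import Data.Nat as ℕ using (ℕ; zero; suc; _+_; _*_; _∸_; _≤_; _<_; z≤n; s≤s; _⊔_; _≤?_; ⌊_/2⌋)
open import Data.Nat.Coprimality as Coprimality using (Coprime; 1-coprimeTo)
open import Data.Nat.Properties as ℕ using (≤-refl; +-mono-≤; +-monoˡ-≤; +-monoʳ-≤; *-monoʳ-≤)
open import Data.Nat.Solver using (module +-*-Solver)
open import Data.Product using (Σ; ∃; ∃₂; ∃-syntax; _×_; _,_; proj₁; proj₂)
open import Data.Rational as ℚ using (ℚ; mkℚ; 0ℚ; 1ℚ)
import Data.Rational.Properties as ℚ
open import Data.Rational.Unnormalised using (*≤*; *<*)
import Data.Rational.Unnormalised.Properties as ℚᵘ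
open import Data.Sum using (_⊎_; inj₁; inj₂; reduce)
import Data.Sum.Properties as Sum
open import Data.Vec.Functional.Relation.Binary.Pointwise using (Pointwise)
open import Function using (_∘_; flip)
open import Function.Definitions using (Injective)
open import Relation.Binary.Definitions using (DecidableEquality)
open import Relation.Binary.PropositionalEquality as ≡
  using (_≡_; _≢_; _≗_; refl; trans; cong; cong₂; subst; subst₂; module ≡-Reasoning)
open import Relation.Nullary using (¬_; Dec; does; yes; no)
open import Relation.Nullary.Decidable using (⌊_⌋; map′; dec-true; _×-dec_; _→-dec_; ¬?)

open +-*-Solver using (solve; _:+_; _:*_; _:=_; con)

-- Counting over Fin

∧-true-left : ∀ {x y} → x ∧ y ≡ true → x ≡ true
∧-true-left {true} _ = refl

∧-true-right : ∀ {x y} → x ∧ y ≡ true → y ≡ true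
∧-true-right {true} p = p

not-both : ∀ {b} → b ≡ true → not b ≡ true → ⊥
not-both refl ()

indicator : Bool → ℕ
indicator b = if b then 1 else 0

sumFin-cong : ∀ {n} {f g : Fin n → ℕ} → (∀ i → f i ≡ g i) → sumFin f ≡ sumFin g
sumFin-cong {zero}  f≡g = refl
sumFin-cong {suc n} f≡g = cong₂ _+_ (f≡g zero) (sumFin-cong (f≡g ∘ suc))

sumFin-mono : ∀ {n} {f g : Fin n → ℕ} → (∀ i → f i ≤ g i) → sumFin f ≤ sumFin g
sumFin-mono {zero}  f≤g = z≤n
sumFin-mono {suc n} f≤g = +-mono-≤ (f≤g zero) (sumFin-mono (f≤g ∘ suc))

sumFin-zero : ∀ n → sumFin {n} (λ _ → 0) ≡ 0
sumFin-zero zero    = refl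
sumFin-zero (suc n) = sumFin-zero n

sumFin-const : ∀ n c → sumFin {n} (λ _ → c) ≡ n * c
sumFin-const zero    c = refl
sumFin-const (suc n) c = cong (c +_) (sumFin-const n c)

sumFin-+ : ∀ {n} (f g : Fin n → ℕ) → sumFin (λ i → f i + g i) ≡ sumFin f + sumFin g
sumFin-+ {zero}  f g = refl
sumFin-+ {suc n} f g = trans (cong (f zero + g zero +_) (sumFin-+ (f ∘ suc) (g ∘ suc)))
                             (interchange (f zero) (g zero) _ _)
  where
  interchange : ∀ a b c d → (a + b) + (c + d) ≡ (a + c) + (b + d)
  interchange = solve 4 (λ a b c d → (a :+ b) :+ (c :+ d) := (a :+ c) :+ (b :+ d)) refl

sumFin-swap : ∀ {m n} (h : Fin m → Fin n → ℕ) →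
  sumFin (λ i → sumFin (h i)) ≡ sumFin (λ j → sumFin (λ i → h i j))
sumFin-swap {zero}  {n} h = ≡.sym (sumFin-zero n)
sumFin-swap {suc m} {n} h = begin
  sumFin (h zero) + sumFin (λ i → sumFin (h (suc i)))
    ≡⟨ cong (sumFin (h zero) +_) (sumFin-swap (h ∘ suc)) ⟩
  sumFin (h zero) + sumFin (λ j → sumFin (λ i → h (suc i) j))
    ≡⟨ ≡.sym (sumFin-+ (h zero) _) ⟩
  sumFin (λ j → h zero j + sumFin (λ i → h (suc i) j)) ∎
  where open ≡-Reasoning

sumFin-splitAt : ∀ a b (h : Fin (a + b) → ℕ) →
  sumFin h ≡ sumFin (λ i → h (i ↑ˡ b)) + sumFin (λ j → h (a ↑ʳ j))
sumFin-splitAt zero    b h = refl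
sumFin-splitAt (suc a) b h = trans (cong (h zero +_) (sumFin-splitAt a b (h ∘ suc)))
                                   (≡.sym (ℕ.+-assoc (h zero) _ _))

count-sumFin : ∀ {n} (f : Fin n → Bool) → count f ≡ sumFin (indicator ∘ f)
count-sumFin {zero}  f = refl
count-sumFin {suc n} f = cong (indicator (f zero) +_) (count-sumFin (f ∘ suc))

count-cong : ∀ {n} {f g : Fin n → Bool} → (∀ i → f i ≡ g i) → count f ≡ count g
count-cong {zero}  f≡g = refl
count-cong {suc n} f≡g = cong₂ _+_ (cong indicator (f≡g zero)) (count-cong (f≡g ∘ suc))

count-mono : ∀ {n} {f g : Fin n → Bool} → (∀ i → f i ≡ true → g i ≡ true) → count f ≤ count g
count-mono {zero}  f⇒g = z≤n
count-mono {suc n} {f} {g} f⇒g = +-mono-≤ (indicator-mono (f⇒g zero)) (count-mono (f⇒g ∘ suc))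
  where
  indicator-mono : ∀ {x y} → (x ≡ true → y ≡ true) → indicator x ≤ indicator y
  indicator-mono {false}         _   = z≤n
  indicator-mono {true}  {true}  _   = ≤-refl
  indicator-mono {true}  {false} x⇒y with () ← x⇒y refl

count≤ : ∀ {n} (f : Fin n → Bool) → count f ≤ n
count≤ {zero}  f = z≤n
count≤ {suc n} f with f zero
... | true  = s≤s (count≤ (f ∘ suc))
... | false = ℕ.m≤n⇒m≤1+n (count≤ (f ∘ suc))

count-split : ∀ {n} (f p : Fin n → Bool) →
  count f ≡ count (λ i → f i ∧ p i) + count (λ i → f i ∧ not (p i))
count-split f p = begin
  count f                                                  ≡⟨ count-sumFin f ⟩
  sumFin (indicator ∘ f)                                   ≡⟨ sumFin-cong (λ i → indicator-split (f i) (p i)) ⟩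
  sumFin (λ i → indicator (f i ∧ p i) + indicator (f i ∧ not (p i)))
    ≡⟨ sumFin-+ (λ i → indicator (f i ∧ p i)) (λ i → indicator (f i ∧ not (p i))) ⟩
  sumFin (λ i → indicator (f i ∧ p i)) + sumFin (λ i → indicator (f i ∧ not (p i)))
    ≡⟨ ≡.sym (cong₂ _+_ (count-sumFin (λ i → f i ∧ p i)) (count-sumFin (λ i → f i ∧ not (p i)))) ⟩
  count (λ i → f i ∧ p i) + count (λ i → f i ∧ not (p i)) ∎
  where
  open ≡-Reasoning
  indicator-split : ∀ x y → indicator x ≡ indicator (x ∧ y) + indicator (x ∧ not y)
  indicator-split false y     = refl
  indicator-split true  false = refl
  indicator-split true  true  = refl

count-complement : ∀ {n} (f : Fin n → Bool) → count f + count (not ∘ f) ≡ n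
count-complement {zero}  f = refl
count-complement {suc n} f with f zero
... | true  = cong suc (count-complement (f ∘ suc))
... | false = trans (ℕ.+-suc _ _) (cong suc (count-complement (f ∘ suc)))

count-positive : ∀ {n} (f : Fin n → Bool) → 1 ≤ count f → ∃ λ i → f i ≡ true
count-positive {suc n} f 1≤count with f zero in f0
... | true  = zero , f0
... | false = let (i , fi) = count-positive (f ∘ suc) 1≤count in suc i , fi

bedges-sumFin : ∀ {m n} (B : BGraph m n) → bedges B ≡ sumFin (λ a → sumFin (λ b → indicator (B a b)))
bedges-sumFin B = sumFin-cong (λ a → count-sumFin (B a))

bedges-cong : ∀ {m n} {B C : BGraph m n} → (∀ a b → B a b ≡ C a b) → bedges B ≡ bedges C
bedges-cong B≡C = sumFin-cong (λ a → count-cong (B≡C a))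

bedges-mono : ∀ {m n} {B C : BGraph m n} → (∀ a b → B a b ≡ true → C a b ≡ true) → bedges B ≤ bedges C
bedges-mono B⇒C = sumFin-mono (λ a → count-mono (B⇒C a))

bedges-transpose : ∀ {m n} (B : BGraph m n) → bedges B ≡ bedges (flip B)
bedges-transpose B = begin
  bedges B                                                      ≡⟨ bedges-sumFin B ⟩
  sumFin (λ a → sumFin (λ b → indicator (B a b)))               ≡⟨ sumFin-swap (λ a b → indicator (B a b)) ⟩
  sumFin (λ b → sumFin (λ a → indicator (B a b)))               ≡⟨ ≡.sym (bedges-sumFin (flip B)) ⟩
  bedges (flip B)                                               ∎
  where open ≡-Reasoning

bedges-split : ∀ {m n} (B P : BGraph m n) →
  bedges B ≡ bedges (λ a b → B a b ∧ P a b) + bedges (λ a b → B a b ∧ not (P a b))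
bedges-split B P = trans (sumFin-cong (λ a → count-split (B a) (P a)))
  (sumFin-+ (λ a → count (λ b → B a b ∧ P a b)) (λ a → count (λ b → B a b ∧ not (P a b))))

bedges≤ : ∀ {m n} (B : BGraph m n) → bedges B ≤ m * n
bedges≤ {m} {n} B = subst (bedges B ≤_) (sumFin-const m n) (sumFin-mono (count≤ ∘ B))

bedges-empty : ∀ m n → bedges {m} {n} (λ _ _ → false) ≡ 0
bedges-empty m n = trans (bedges-sumFin {m} {n} _) (trans (sumFin-cong {m} (λ _ → sumFin-zero n)) (sumFin-zero m))

edges+edges≡bedges : ∀ {n} (G : Graph n) → edges G + edges G ≡ bedges (adj G)
edges+edges≡bedges G = ≡.sym (begin
  bedges (adj G)
    ≡⟨ bedges-split (adj G) less ⟩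
  edges G + bedges (λ i j → adj G i j ∧ not (less i j))
    ≡⟨ cong (edges G +_) (bedges-cong below≡above) ⟩
  edges G + bedges (flip (λ i j → adj G i j ∧ less i j))
    ≡⟨ cong (edges G +_) (≡.sym (bedges-transpose (λ i j → adj G i j ∧ less i j))) ⟩
  edges G + edges G ∎)
  where
  open ≡-Reasoning
  less : ∀ {n} → Fin n → Fin n → Bool
  less i j = ⌊ i <? j ⌋
  not-less : ∀ {n} (i j : Fin n) → i ≢ j → not (less i j) ≡ less j i
  not-less i j i≢j with i <? j | j <? i
  ... | yes i<j | yes j<i = ⊥-elim (ℕ.<-asym i<j j<i)
  ... | yes _   | no  _   = refl
  ... | no  _   | yes _   = refl
  ... | no i≮j  | no j≮i  = ⊥-elim (i≢j (toℕ-injective (ℕ.≤-antisym (ℕ.≮⇒≥ j≮i) (ℕ.≮⇒≥ i≮j))))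
  below≡above : ∀ i j → adj G i j ∧ not (less i j) ≡ adj G j i ∧ less j i
  below≡above i j with i Fin.≟ j
  ... | yes refl rewrite irrefl G i = refl
  ... | no  i≢j  rewrite not-less i j i≢j | sym G i j = refl

-- Maximum degree and maximum cuts

foldr-⊔-attained : ∀ {A : Set} (f : A → ℕ) x xs → ∃ λ y → f y ≡ foldr _⊔_ 0 (map f (x ∷ xs))
foldr-⊔-attained f x []       = x , ≡.sym (ℕ.⊔-identityʳ (f x))
foldr-⊔-attained f x (y ∷ ys) with ℕ.⊔-sel (f x) (foldr _⊔_ 0 (map f (y ∷ ys)))
... | inj₁ fx≡max = x , ≡.sym fx≡max
... | inj₂ max≡rest with foldr-⊔-attained f y ys
...   | z , fz≡rest = z , trans fz≡rest (≡.sym max≡rest)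

maxDegree-attained : ∀ {n} (G : Graph n) → Fin n → ∃ λ x → degree G x ≡ maxDegree G
maxDegree-attained {suc n} G _ = foldr-⊔-attained (degree G) zero (List.tabulate suc)

bedges-peel : ∀ {n} (h : BGraph (suc n) (suc n)) → (∀ u w → h u w ≡ h w u) → h zero zero ≡ false →
  bedges h ≡ (count (h zero ∘ suc) + count (h zero ∘ suc)) + bedges (λ u w → h (suc u) (suc w))
bedges-peel h h-sym h00 = begin
  (indicator (h zero zero) + c) + sumFin (λ i → indicator (h (suc i) zero) + count (h (suc i) ∘ suc))
    ≡⟨ cong₂ _+_ (cong (λ b → indicator b + c) h00)
                 (sumFin-+ (λ i → indicator (h (suc i) zero)) (λ i → count (h (suc i) ∘ suc))) ⟩
  c + (sumFin (λ i → indicator (h (suc i) zero)) + h′)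
    ≡⟨ cong (λ t → c + (t + h′)) (trans (≡.sym (count-sumFin (λ i → h (suc i) zero)))
                                         (count-cong (λ i → h-sym (suc i) zero))) ⟩
  c + (c + h′)
    ≡⟨ ≡.sym (ℕ.+-assoc c c h′) ⟩
  (c + c) + h′ ∎
  where
  open ≡-Reasoning
  c  = count (h zero ∘ suc)
  h′ = bedges (λ u w → h (suc u) (suc w))

better-side : ∀ a b → ∃ λ s → a + b ≤ 2 * (if s then b else a)
better-side a b with a ≤? b
... | yes a≤b = true  , subst (a + b ≤_) (cong (b +_) (≡.sym (ℕ.+-identityʳ b))) (+-monoˡ-≤ b a≤b)
... | no  a≰b = false , subst (a + b ≤_) (cong (a +_) (≡.sym (ℕ.+-identityʳ a)))
                              (+-monoʳ-≤ a (ℕ.<⇒≤ (ℕ.≰⇒> a≰b)))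

cut : ∀ {n} → BGraph n n → (Fin n → Bool) → BGraph n n
cut g s u w = g u w ∧ (s u xor s w)

-- Greedy: vertex 0 goes to the side opposite to the majority of its already placed neighbours.
max-cut : ∀ {n} (g : BGraph n n) → (∀ u w → g u w ≡ g w u) → (∀ u → g u u ≡ false) →
  ∃ λ s → bedges g ≤ 2 * bedges (cut g s)
max-cut {zero}  g g-sym g-irr = (λ ()) , z≤n
max-cut {suc n} g g-sym g-irr = extend (max-cut g′ (λ u w → g-sym (suc u) (suc w)) (g-irr ∘ suc))
  where
  g′ : BGraph n n
  g′ u w = g (suc u) (suc w)
  r : Fin n → Bool
  r = g zero ∘ suc
  extend : (∃ λ s′ → bedges g′ ≤ 2 * bedges (cut g′ s′)) → ∃ λ s → bedges g ≤ 2 * bedges (cut g s)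
  extend (s′ , ih) with better-side (count (λ j → r j ∧ s′ j)) (count (λ j → r j ∧ not (s′ j)))
  ... | s₀ , balanced = s , (begin
    bedges g                                  ≡⟨ bedges-peel g g-sym (g-irr zero) ⟩
    (count r + count r) + bedges g′           ≤⟨ +-mono-≤ (+-mono-≤ r≤ r≤) ih ⟩
    (2 * c + 2 * c) + 2 * bedges (cut g′ s′)  ≡⟨ ≡.sym (2*-distrib c (bedges (cut g′ s′))) ⟩
    2 * ((c + c) + bedges (cut g′ s′))        ≡⟨ cong (2 *_) (≡.sym (bedges-peel (cut g s) cut-sym
                                                                       (cong (_∧ (s₀ xor s₀)) (g-irr zero)))) ⟩
    2 * bedges (cut g s)                      ∎)
    where
    open ℕ.≤-Reasoning
    s : Fin (suc n) → Bool
    s zero    = s₀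
    s (suc j) = s′ j
    c : ℕ
    c = count (λ j → r j ∧ (s₀ xor s′ j))
    crossing : ∀ s₀ → count (λ j → r j ∧ (s₀ xor s′ j))
                      ≡ (if s₀ then count (λ j → r j ∧ not (s′ j)) else count (λ j → r j ∧ s′ j))
    crossing true  = refl
    crossing false = refl
    r≤ : count r ≤ 2 * c
    r≤ = subst₂ _≤_ (≡.sym (count-split r s′)) (cong (2 *_) (≡.sym (crossing s₀))) balanced
    cut-sym : ∀ u w → cut g s u w ≡ cut g s w u
    cut-sym u w = cong₂ _∧_ (g-sym u w) (xor-comm (s u) (s w))
    2*-distrib : ∀ a b → 2 * ((a + a) + b) ≡ (2 * a + 2 * a) + 2 * b
    2*-distrib a b = trans (ℕ.*-distribˡ-+ 2 (a + a) b) (cong (_+ 2 * b) (ℕ.*-distribˡ-+ 2 a a))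

cut≡directed-cut+directed-cut : ∀ {n} (g : BGraph n n) (s : Fin n → Bool) → (∀ u w → g u w ≡ g w u) →
  bedges (cut g s) ≡ bedges (λ u w → g u w ∧ (s u ∧ not (s w))) + bedges (λ u w → g u w ∧ (s u ∧ not (s w)))
cut≡directed-cut+directed-cut g s g-sym = trans (bedges-split (cut g s) (λ u _ → s u)) (cong₂ _+_
  (bedges-cong (λ u w → leaving (g u w) (s u) (s w)))
  (trans (bedges-cong (λ u w → entering (g u w) (s u) (s w)))
  (trans (bedges-transpose (λ u w → g u w ∧ (not (s u) ∧ s w)))
         (bedges-cong (λ w u → cong₂ _∧_ (g-sym u w) (∧-comm (not (s u)) (s w)))))))
  where
  leaving : ∀ a x y → (a ∧ (x xor y)) ∧ x ≡ a ∧ (x ∧ not y)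
  leaving false x     y = refl
  leaving true  true  y = ∧-identityʳ (not y)
  leaving true  false y = ∧-zeroʳ y
  entering : ∀ a x y → (a ∧ (x xor y)) ∧ not x ≡ a ∧ (not x ∧ y)
  entering false x     y = refl
  entering true  true  y = ∧-zeroʳ (not y)
  entering true  false y = ∧-identityʳ y

-- Subgraphs and disjoint unions

Enumeration : ∀ {n} → (Fin n → Bool) → Set
Enumeration {n} R = Σ (Fin (count R) → Fin n) λ index →
  Injective _≡_ _≡_ index × (∀ i → R (index i) ≡ true) ×
  (∀ h → sumFin (h ∘ index) ≡ sumFin (λ u → if R u then h u else 0))

enumerate : ∀ {n} (R : Fin n → Bool) → Enumeration R
enumerate {zero}  R = (λ ()) , (λ {}) , (λ ()) , (λ _ → refl)
enumerate {suc n} R with R zero in R0 | enumerate (R ∘ suc)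
... | true  | index , injective , member , sumFin-index = index′ , injective′ , member′ , sumFin-index′
  where
  index′ : Fin (suc (count (R ∘ suc))) → Fin (suc n)
  index′ zero    = zero
  index′ (suc i) = suc (index i)
  injective′ : Injective _≡_ _≡_ index′
  injective′ {zero}  {zero}  _ = refl
  injective′ {suc i} {suc j} p = cong suc (injective (suc-injective p))
  member′ : ∀ i → R (index′ i) ≡ true
  member′ zero    = R0
  member′ (suc i) = member i
  sumFin-index′ : ∀ h → sumFin (h ∘ index′) ≡ h zero + sumFin (λ u → if R (suc u) then h (suc u) else 0)
  sumFin-index′ h = cong (h zero +_) (sumFin-index (h ∘ suc))
... | false | index , injective , member , sumFin-index =
  suc ∘ index , injective ∘ suc-injective , member , sumFin-index ∘ (_∘ suc)

induced : ∀ {m n} → Graph n → (Fin m → Fin n) → Graph m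
induced G e = record
  { adj = λ i j → adj G (e i) (e j) ; sym = λ i j → sym G (e i) (e j) ; irrefl = irrefl G ∘ e }

emptyGraph : ∀ n → Graph n
emptyGraph n = record { adj = λ _ _ → false ; sym = λ _ _ → refl ; irrefl = λ _ → refl }

sumAdj : ∀ {a b} → Graph a → Graph b → Fin a ⊎ Fin b → Fin a ⊎ Fin b → Bool
sumAdj G₁ G₂ (inj₁ i) (inj₁ j) = adj G₁ i j
sumAdj G₁ G₂ (inj₂ i) (inj₂ j) = adj G₂ i j
sumAdj G₁ G₂ _        _        = false

sumAdj-sym : ∀ {a b} (G₁ : Graph a) (G₂ : Graph b) x y → sumAdj G₁ G₂ x y ≡ sumAdj G₁ G₂ y x
sumAdj-sym G₁ G₂ (inj₁ i) (inj₁ j) = sym G₁ i j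
sumAdj-sym G₁ G₂ (inj₁ i) (inj₂ j) = refl
sumAdj-sym G₁ G₂ (inj₂ i) (inj₁ j) = refl
sumAdj-sym G₁ G₂ (inj₂ i) (inj₂ j) = sym G₂ i j

sumAdj-irrefl : ∀ {a b} (G₁ : Graph a) (G₂ : Graph b) x → sumAdj G₁ G₂ x x ≡ false
sumAdj-irrefl G₁ G₂ (inj₁ i) = irrefl G₁ i
sumAdj-irrefl G₁ G₂ (inj₂ i) = irrefl G₂ i

infixr 5 _⊕_
_⊕_ : ∀ {a b} → Graph a → Graph b → Graph (a + b)
_⊕_ {a} G₁ G₂ = record
  { adj    = λ u w → sumAdj G₁ G₂ (splitAt a u) (splitAt a w)
  ; sym    = λ u w → sumAdj-sym G₁ G₂ (splitAt a u) (splitAt a w)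
  ; irrefl = λ u → sumAdj-irrefl G₁ G₂ (splitAt a u) }

bedges-induced : ∀ {n} (G : Graph n) (R : Fin n → Bool) ((index , _) : Enumeration R) →
  bedges (adj (induced G index)) ≡ bedges (λ u w → adj G u w ∧ (R u ∧ R w))
bedges-induced {n} G R (index , _ , _ , sumFin-index) = begin
  bedges (λ i j → adj G (index i) (index j))
    ≡⟨ bedges-sumFin (λ i j → adj G (index i) (index j)) ⟩
  sumFin (λ i → sumFin (λ j → indicator (adj G (index i) (index j))))
    ≡⟨ sumFin-cong (λ i → sumFin-index (indicator ∘ adj G (index i))) ⟩
  sumFin (row ∘ index)
    ≡⟨ sumFin-index row ⟩
  sumFin (λ u → if R u then row u else 0)
    ≡⟨ sumFin-cong restrict-row ⟩
  sumFin (λ u → sumFin (λ w → indicator (adj G u w ∧ (R u ∧ R w))))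
    ≡⟨ ≡.sym (bedges-sumFin (λ u w → adj G u w ∧ (R u ∧ R w))) ⟩
  bedges (λ u w → adj G u w ∧ (R u ∧ R w)) ∎
  where
  open ≡-Reasoning
  row : Fin n → ℕ
  row u = sumFin (λ w → if R w then indicator (adj G u w) else 0)
  restrict : ∀ x y → (if y then indicator x else 0) ≡ indicator (x ∧ (true ∧ y))
  restrict x false = cong indicator (≡.sym (∧-zeroʳ x))
  restrict x true  = cong indicator (≡.sym (∧-identityʳ x))
  restrict-row : ∀ u → (if R u then row u else 0) ≡ sumFin (λ w → indicator (adj G u w ∧ (R u ∧ R w)))
  restrict-row u with R u
  ... | true  = sumFin-cong (λ w → restrict (adj G u w) (R w))
  ... | false = ≡.sym (trans (sumFin-cong {n} (λ w → cong indicator (∧-zeroʳ (adj G u w)))) (sumFin-zero n))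

bedges-⊕ : ∀ {a b} (G₁ : Graph a) (G₂ : Graph b) →
  bedges (adj (G₁ ⊕ G₂)) ≡ bedges (adj G₁) + bedges (adj G₂)
bedges-⊕ {a} {b} G₁ G₂ = begin
  bedges (adj (G₁ ⊕ G₂))
    ≡⟨ bedges-sumFin (adj (G₁ ⊕ G₂)) ⟩
  sumFin row
    ≡⟨ sumFin-splitAt a b row ⟩
  sumFin (λ i → row (i ↑ˡ b)) + sumFin (λ j → row (a ↑ʳ j))
    ≡⟨ cong₂ _+_ (sumFin-cong left-row) (sumFin-cong right-row) ⟩
  sumFin (λ i → sumFin (λ j → indicator (adj G₁ i j))) + sumFin (λ i → sumFin (λ j → indicator (adj G₂ i j)))
    ≡⟨ ≡.sym (cong₂ _+_ (bedges-sumFin (adj G₁)) (bedges-sumFin (adj G₂))) ⟩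
  bedges (adj G₁) + bedges (adj G₂) ∎
  where
  open ≡-Reasoning
  row : Fin (a + b) → ℕ
  row u = sumFin (λ w → indicator (adj (G₁ ⊕ G₂) u w))
  entry : Fin a ⊎ Fin b → Fin a ⊎ Fin b → ℕ
  entry x y = indicator (sumAdj G₁ G₂ x y)
  split-row : ∀ u →
    row u ≡ sumFin (λ j → entry (splitAt a u) (inj₁ j)) + sumFin (λ j → entry (splitAt a u) (inj₂ j))
  split-row u = trans (sumFin-splitAt a b (λ w → indicator (adj (G₁ ⊕ G₂) u w)))
    (cong₂ _+_ (sumFin-cong (λ j → cong (entry (splitAt a u)) (splitAt-↑ˡ a j b)))
               (sumFin-cong (λ j → cong (entry (splitAt a u)) (splitAt-↑ʳ a b j))))
  left-row : ∀ i → row (i ↑ˡ b) ≡ sumFin (λ j → indicator (adj G₁ i j))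
  left-row i rewrite split-row (i ↑ˡ b) | splitAt-↑ˡ a i b =
    trans (cong (sumFin (λ j → indicator (adj G₁ i j)) +_) (sumFin-zero b)) (ℕ.+-identityʳ _)
  right-row : ∀ i → row (a ↑ʳ i) ≡ sumFin (λ j → indicator (adj G₂ i j))
  right-row i rewrite split-row (a ↑ʳ i) | splitAt-↑ʳ a b i =
    cong (_+ sumFin (λ j → indicator (adj G₂ i j))) (sumFin-zero a)

-- Cycles, cherries and connectivity

HasEdge : ∀ {k} → Graph k → Set
HasEdge F = ∃₂ λ i j → adj F i j ≡ true

NoIsolated : ∀ {k} → Graph k → Set
NoIsolated F = ∀ i → ∃ λ j → adj F i j ≡ true

-- A triangle cannot be properly 2-coloured, so the cycle has at least four distinct vertices.
proper-cycle⇒4≤order : ∀ {k} (F : Graph k) (part : Bipartition k) → Proper F part → HasCycle F → 4 ≤ k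
proper-cycle⇒4≤order F part proper (zero , c , _ , c-adj , c-last) =
  ⊥-elim (no-proper-triangle (part (c zero)) (part (c (suc zero))) (part (c (suc (suc zero))))
           (proper _ _ (c-adj zero)) (proper _ _ (c-adj (suc zero))) (proper _ _ c-last))
  where
  no-proper-triangle : ∀ (a b c : Bool) → a ≢ b → b ≢ c → c ≢ a → ⊥
  no-proper-triangle false false _     a≢b _   _   = a≢b refl
  no-proper-triangle true  true  _     a≢b _   _   = a≢b refl
  no-proper-triangle false true  false _   _   c≢a = c≢a refl
  no-proper-triangle false true  true  _   b≢c _   = b≢c refl
  no-proper-triangle true  false false _   b≢c _   = b≢c refl
  no-proper-triangle true  false true  _   _   c≢a = c≢a refl
proper-cycle⇒4≤order F part proper (suc l , c , c-injective , _) =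
  ℕ.≤-trans (s≤s (s≤s (s≤s (s≤s z≤n)))) (injective⇒≤ c-injective)

reach-first-step : ∀ {k} {F : Graph k} {i j} → Reach F i j → i ≢ j → ∃ λ y → adj F i y ≡ true
reach-first-step here         i≢i = ⊥-elim (i≢i refl)
reach-first-step (step i~y _) _   = _ , i~y

connected⇒no-isolated : ∀ {k} (F : Graph k) → Connected F → ∀ {p q : Fin k} → p ≢ q → NoIsolated F
connected⇒no-isolated F connected {p} {q} p≢q i with i ≟ p
... | yes refl = reach-first-step (connected i q) p≢q
... | no  i≢p  = reach-first-step (connected i p) i≢p

Cherry : ∀ {k} → Graph k → Set
Cherry F = ∃ λ w → ∃₂ λ p q → p ≢ q × adj F w p ≡ true × adj F w q ≡ true


module _ {k} (F : Graph k) (¬cherry : ¬ Cherry F) where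

  cherry-free⇒unique-neighbour : ∀ {w p q} → adj F w p ≡ true → adj F w q ≡ true → p ≡ q
  cherry-free⇒unique-neighbour {w} {p} {q} w~p w~q with p ≟ q
  ... | yes p≡q = p≡q
  ... | no  p≢q = ⊥-elim (¬cherry (w , p , q , p≢q , w~p , w~q))

  cherry-free-reach⇒≡⊎adj : ∀ {a c} → Reach F a c → c ≡ a ⊎ adj F a c ≡ true
  cherry-free-reach⇒≡⊎adj here = inj₁ refl
  cherry-free-reach⇒≡⊎adj (step {a} a~y rest) with cherry-free-reach⇒≡⊎adj rest
  ... | inj₁ refl = inj₂ a~y
  ... | inj₂ y~c  = inj₁ (cherry-free⇒unique-neighbour y~c (trans (sym F _ a) a~y))

connected⇒cherry : ∀ {k} (F : Graph k) → 3 ≤ k → Connected F → Cherry F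
connected⇒cherry F (s≤s (s≤s (s≤s _))) connected
  with any? (λ w → any? (λ p → any? (λ q →
         ¬? (p ≟ q) ×-dec (adj F w p Bool.≟ true) ×-dec (adj F w q Bool.≟ true))))
... | yes cherry = cherry
... | no  ¬cherry
  with cherry-free-reach⇒≡⊎adj F ¬cherry (connected zero (suc zero))
     | cherry-free-reach⇒≡⊎adj F ¬cherry (connected zero (suc (suc zero)))
... | inj₁ ()  | _
... | inj₂ _   | inj₁ ()
... | inj₂ 0~1 | inj₂ 0~2 with () ← cherry-free⇒unique-neighbour F ¬cherry 0~1 0~2

-- Doubling the non-neighbourhood

splitAt-injective : ∀ m {n} → Injective _≡_ _≡_ (splitAt m {n})
splitAt-injective m {n} {u} {w} eq = trans (≡.sym (join-splitAt m n u)) (trans (cong (join m n) eq) (join-splitAt m n w))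

module Doubling {n} (G : Graph n) (R : Fin n → Bool) (a₀ : Fin n) (a₀∉R : R a₀ ≡ false) (r : ℕ) where

  m : ℕ
  m = count R

  index : Fin m → Fin n
  index = proj₁ (enumerate R)

  index-injective : Injective _≡_ _≡_ index
  index-injective = proj₁ (proj₂ (enumerate R))

  index-member : ∀ i → R (index i) ≡ true
  index-member = proj₁ (proj₂ (proj₂ (enumerate R)))

  H : Graph m
  H = induced G index

  doubled : Graph (m + (m + r))
  doubled = H ⊕ H ⊕ emptyGraph r

  bedges-doubled :
    bedges (adj doubled) ≡ bedges (λ u w → adj G u w ∧ (R u ∧ R w)) + bedges (λ u w → adj G u w ∧ (R u ∧ R w))
  bedges-doubled = begin
    bedges (adj doubled)                         ≡⟨ bedges-⊕ H (H ⊕ emptyGraph r) ⟩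
    bedges (adj H) + bedges (adj (H ⊕ emptyGraph r))
      ≡⟨ cong (bedges (adj H) +_) (trans (bedges-⊕ H (emptyGraph r))
           (trans (cong (bedges (adj H) +_) (bedges-empty r r)) (ℕ.+-identityʳ _))) ⟩
    bedges (adj H) + bedges (adj H)
      ≡⟨ cong₂ _+_ (bedges-induced G R (enumerate R)) (bedges-induced G R (enumerate R)) ⟩
    _ ∎
    where open ≡-Reasoning

  -- just (true , i) and just (false , i): vertex i of the first and second copy of H; nothing: padding.
  Address : Set
  Address = Maybe (Bool × Fin m)

  address-tail : Fin m ⊎ Fin r → Address
  address-tail (inj₁ i) = just (false , i)
  address-tail (inj₂ _) = nothing

  address-split : Fin m ⊎ Fin (m + r) → Address
  address-split (inj₁ i) = just (true , i)
  address-split (inj₂ u) = address-tail (splitAt m u)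

  address : Fin (m + (m + r)) → Address
  address = address-split ∘ splitAt m

  address-tail-false : ∀ s {b i} → address-tail s ≡ just (b , i) → b ≡ false
  address-tail-false (inj₁ _) refl = refl

  address-tail-injective : ∀ s t {c} → address-tail s ≡ just c → address-tail t ≡ just c → s ≡ t
  address-tail-injective (inj₁ i) (inj₁ .i) refl refl = refl

  address-split-injective : ∀ s t {c} → address-split s ≡ just c → address-split t ≡ just c → s ≡ t
  address-split-injective (inj₁ i) (inj₁ .i) refl refl = refl
  address-split-injective (inj₁ i) (inj₂ u) refl q with () ← address-tail-false (splitAt m u) q
  address-split-injective (inj₂ u) (inj₁ i) p refl with () ← address-tail-false (splitAt m u) p
  address-split-injective (inj₂ u) (inj₂ w) p q =
    cong inj₂ (splitAt-injective m (address-tail-injective (splitAt m u) (splitAt m w) p q))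

  address-injective : ∀ u w {c} → address u ≡ just c → address w ≡ just c → u ≡ w
  address-injective u w p q = splitAt-injective m (address-split-injective (splitAt m u) (splitAt m w) p q)

  SameCopyEdge : Address → Address → Set
  SameCopyEdge x y = ∃ λ b → ∃₂ λ i j → x ≡ just (b , i) × y ≡ just (b , j) × adj H i j ≡ true

  address-tail-edge : ∀ s t → sumAdj H (emptyGraph r) s t ≡ true → SameCopyEdge (address-tail s) (address-tail t)
  address-tail-edge (inj₁ i) (inj₁ j) a  = false , i , j , refl , refl , a
  address-tail-edge (inj₁ i) (inj₂ j) ()
  address-tail-edge (inj₂ i) (inj₁ j) ()
  address-tail-edge (inj₂ i) (inj₂ j) ()

  address-split-edge : ∀ s t → sumAdj H (H ⊕ emptyGraph r) s t ≡ true →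
    SameCopyEdge (address-split s) (address-split t)
  address-split-edge (inj₁ i) (inj₁ j) a  = true , i , j , refl , refl , a
  address-split-edge (inj₁ i) (inj₂ w) ()
  address-split-edge (inj₂ u) (inj₁ j) ()
  address-split-edge (inj₂ u) (inj₂ w) a  = address-tail-edge (splitAt m u) (splitAt m w) a

  address-edge : ∀ u w → adj doubled u w ≡ true → SameCopyEdge (address u) (address w)
  address-edge u w = address-split-edge (splitAt m u) (splitAt m w)

  InCopy : Bool → Address → Set
  InCopy b x = ∃ λ c → x ≡ just (b , c)

  copy : Address → Maybe Bool
  copy = Maybe.map proj₁

  copy-edge : ∀ u w → adj doubled u w ≡ true → copy (address u) ≡ copy (address w)
  copy-edge u w a with address-edge u w a
  ... | b , i , j , p , q , _ rewrite p | q = refl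

  copy⇒InCopy : ∀ {b} x → copy x ≡ just b → InCopy b x
  copy⇒InCopy (just (b , i)) refl = i , refl

  other-copy⇒¬InCopy : ∀ {x b b₀ i} → x ≡ just (b , i) → b ≢ b₀ → ¬ InCopy b₀ x
  other-copy⇒¬InCopy refl b≢b₀ (_ , refl) = b≢b₀ refl

  -- As a₀ ∉ R, the default value a₀ never collides with a vertex placed from copy b₀.
  place : Bool → Address → Fin n
  place b₀ nothing = a₀
  place b₀ (just (b , i)) with b Bool.≟ b₀
  ... | yes _ = index i
  ... | no  _ = a₀

  place-in-copy : ∀ {b₀ x} c → x ≡ just (b₀ , c) → place b₀ x ≡ index c
  place-in-copy {b₀} c refl with b₀ Bool.≟ b₀
  ... | yes _    = refl
  ... | no b₀≢b₀ = ⊥-elim (b₀≢b₀ refl)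

  place-view : ∀ b₀ x → InCopy b₀ x ⊎ (place b₀ x ≡ a₀ × ¬ InCopy b₀ x)
  place-view b₀ nothing = inj₂ (refl , λ ())
  place-view b₀ (just (b , i)) with b Bool.≟ b₀
  ... | yes refl = inj₁ (i , refl)
  ... | no  b≢b₀ = inj₂ (refl , λ { (_ , refl) → b≢b₀ refl })

  a₀≢place-in-copy : ∀ {b₀ x} c → x ≡ just (b₀ , c) → a₀ ≢ place b₀ x
  a₀≢place-in-copy c p a₀≡
    with () ← trans (≡.sym a₀∉R) (trans (cong R a₀≡) (trans (cong R (place-in-copy c p)) (index-member c)))

  place-injective : ∀ {b₀} u w → InCopy b₀ (address u) → InCopy b₀ (address w) →
    place b₀ (address u) ≡ place b₀ (address w) → u ≡ w
  place-injective {b₀} u w (c , p) (c′ , p′) eq = address-injective u w p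
    (trans p′ (cong (λ t → just (b₀ , t)) (index-injective
      (trans (≡.sym (place-in-copy c′ p′)) (trans (≡.sym eq) (place-in-copy c p))))))

  module _ {k} (F : Graph (suc k)) (v : Fin (suc k)) (connected : Connected (delete F v)) where

    image-in-one-copy : HasEdge (delete F v) → (φ : Fin (suc k) → Fin (m + (m + r))) →
      (∀ y y′ → adj F y y′ ≡ true → adj doubled (φ y) (φ y′) ≡ true) →
      ∃ λ b₀ → ∀ y → v ≢ y → InCopy b₀ (address (φ y))
    image-in-one-copy (i₀ , j₀ , i₀~j₀) φ φ-adj with address-edge _ _ (φ-adj _ _ i₀~j₀)
    ... | b₀ , _ , _ , i₀-address , _ = b₀ , λ y v≢y → subst (InCopy b₀ ∘ address ∘ φ) (punchIn-punchOut v≢y)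
      (copy⇒InCopy _ (trans (≡.sym (copy-reach (connected i₀ (punchOut v≢y)))) (cong copy i₀-address)))
      where
      copy-reach : ∀ {i j} → Reach (delete F v) i j →
        copy (address (φ (punchIn v i))) ≡ copy (address (φ (punchIn v j)))
      copy-reach here                  = refl
      copy-reach (step {i} {y} a rest) = trans (copy-edge _ _ (φ-adj (punchIn v i) (punchIn v y) a)) (copy-reach rest)

    contains-doubled⇒contains : HasEdge (delete F v) → Contains doubled F → Contains G F
    contains-doubled⇒contains edge (φ , φ-injective , φ-adj) with image-in-one-copy edge φ φ-adj
    ... | b₀ , others-in-copy = ψ , ψ-injective , ψ-adj
      where
      ψ : Fin (suc k) → Fin n
      ψ = place b₀ ∘ address ∘ φ
      outside-copy⇒v : ∀ y → ¬ InCopy b₀ (address (φ y)) → v ≡ y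
      outside-copy⇒v y out with v ≟ y
      ... | yes v≡y = v≡y
      ... | no  v≢y = ⊥-elim (out (others-in-copy y v≢y))
      ψ-injective : Injective _≡_ _≡_ ψ
      ψ-injective {y} {y′} eq with place-view b₀ (address (φ y)) | place-view b₀ (address (φ y′))
      ... | inj₁ in-copy   | inj₁ in-copy′  = φ-injective (place-injective (φ y) (φ y′) in-copy in-copy′ eq)
      ... | inj₁ (c , p)   | inj₂ (a₀≡ , _) = ⊥-elim (a₀≢place-in-copy c p (trans (≡.sym a₀≡) (≡.sym eq)))
      ... | inj₂ (a₀≡ , _) | inj₁ (c′ , p′) = ⊥-elim (a₀≢place-in-copy c′ p′ (trans (≡.sym a₀≡) eq))
      ... | inj₂ (_ , out) | inj₂ (_ , out′) = trans (≡.sym (outside-copy⇒v y out)) (outside-copy⇒v y′ out′)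
      ψ-adj : ∀ y y′ → adj F y y′ ≡ true → adj G (ψ y) (ψ y′) ≡ true
      ψ-adj y y′ a with address-edge (φ y) (φ y′) (φ-adj y y′ a)
      ... | b , i , j , p , q , i~j with b Bool.≟ b₀
      ...   | yes refl = subst₂ (λ s t → adj G s t ≡ true) (≡.sym (place-in-copy i p)) (≡.sym (place-in-copy j q)) i~j
      ...   | no  b≢b₀ with () ← trans (≡.sym a) (subst₂ (λ s t → adj F s t ≡ false)
                                   (outside-copy⇒v y (other-copy⇒¬InCopy p b≢b₀))
                                   (outside-copy⇒v y′ (other-copy⇒¬InCopy q b≢b₀))
                                   (irrefl F v))

-- A vertex x adjacent to all of Q extends every ordered copy of F − v between P and Q to a copy
-- of F in G, with v ↦ x; the orientation is chosen so that the neighbours of v land in Q.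
module Apex {n} (G : Graph n) (x : Fin n) (P Q : Fin n → Bool)
  (disjoint : ∀ u → P u ≡ true → Q u ≡ true → ⊥) (x∉P : P x ≡ false) (x∉Q : Q x ≡ false)
  (Q⊆N[x] : ∀ u → Q u ≡ true → adj G x u ≡ true) where

  between : BGraph n n
  between a b = adj G a b ∧ (P a ∧ Q b)

  oriented : Bool → BGraph n n
  oriented true  = between
  oriented false = λ a b → adj G a b ∧ (Q a ∧ P b)

  bedges-oriented : ∀ s → bedges (oriented s) ≡ bedges between
  bedges-oriented true  = refl
  bedges-oriented false = trans (bedges-transpose (oriented false))
    (bedges-cong (λ b a → cong₂ _∧_ (sym G a b) (∧-comm (Q a) (P b))))

  -- The set receiving the side t of F − v when v lies on side s.
  target : Bool → Bool → Fin n → Bool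
  target true  true  = P
  target true  false = Q
  target false true  = Q
  target false false = P

  x∉target : ∀ s t → target s t x ≢ true
  x∉target true  true  p with () ← trans (≡.sym p) x∉P
  x∉target true  false p with () ← trans (≡.sym p) x∉Q
  x∉target false true  p with () ← trans (≡.sym p) x∉Q
  x∉target false false p with () ← trans (≡.sym p) x∉P

  target-opposite : ∀ s t u → t ≢ s → target s t u ≡ true → Q u ≡ true
  target-opposite true  true  u t≢s _ = ⊥-elim (t≢s refl)
  target-opposite true  false u _   p = p
  target-opposite false true  u _   p = p
  target-opposite false false u t≢s _ = ⊥-elim (t≢s refl)

  edge-target : ∀ s p q → badj (oriented s) p q ≡ true → target s (side p) (reduce p) ≡ true
  edge-target true  (inj₁ a) (inj₂ b) e = ∧-true-left  (∧-true-right {adj G a b} e)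
  edge-target true  (inj₂ b) (inj₁ a) e = ∧-true-right {P a} (∧-true-right {adj G a b} e)
  edge-target false (inj₁ a) (inj₂ b) e = ∧-true-left  (∧-true-right {adj G a b} e)
  edge-target false (inj₂ b) (inj₁ a) e = ∧-true-right {Q a} (∧-true-right {adj G a b} e)

  edge-adj : ∀ s p q → badj (oriented s) p q ≡ true → adj G (reduce p) (reduce q) ≡ true
  edge-adj true  (inj₁ a) (inj₂ b) e = ∧-true-left e
  edge-adj true  (inj₂ b) (inj₁ a) e = trans (sym G b a) (∧-true-left e)
  edge-adj false (inj₁ a) (inj₂ b) e = ∧-true-left e
  edge-adj false (inj₂ b) (inj₁ a) e = trans (sym G b a) (∧-true-left e)

  reduce-injective : ∀ s p q → reduce p ≡ reduce q →
    target s (side p) (reduce p) ≡ true → target s (side q) (reduce q) ≡ true → p ≡ q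
  reduce-injective s     (inj₁ a) (inj₁ b) refl _  _  = refl
  reduce-injective s     (inj₂ a) (inj₂ b) refl _  _  = refl
  reduce-injective true  (inj₁ a) (inj₂ b) refl pa qa = ⊥-elim (disjoint a pa qa)
  reduce-injective false (inj₁ a) (inj₂ b) refl qa pa = ⊥-elim (disjoint a pa qa)
  reduce-injective true  (inj₂ a) (inj₁ b) refl qa pa = ⊥-elim (disjoint a pa qa)
  reduce-injective false (inj₂ a) (inj₁ b) refl pa qa = ⊥-elim (disjoint a pa qa)

  module _ {k} (F : Graph (suc k)) (part : Bipartition (suc k)) (proper : Proper F part) (v : Fin (suc k))
           (no-isolated : NoIsolated (delete F v)) where

    extend : OrdContains (oriented (part v)) (delete F v) (part ∘ punchIn v) → Contains G F
    extend (f , f-injective , f-side , f-adj) = g , g-injective , g-adj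
      where
      s = part v
      on-target : ∀ i → target s (part (punchIn v i)) (reduce (f i)) ≡ true
      on-target i with no-isolated i
      ... | j , i~j = subst (λ t → target s t (reduce (f i)) ≡ true) (f-side i) (edge-target s (f i) (f j) (f-adj i j i~j))
      g : Fin (suc k) → Fin n
      g y with v ≟ y
      ... | yes _   = x
      ... | no  v≢y = reduce (f (punchOut v≢y))
      x∉image : ∀ {y} (v≢y : v ≢ y) → x ≢ reduce (f (punchOut v≢y))
      x∉image v≢y x≡ = x∉target s _ (subst (λ u → target s _ u ≡ true) (≡.sym x≡) (on-target (punchOut v≢y)))
      on-side-target : ∀ i → target s (side (f i)) (reduce (f i)) ≡ true
      on-side-target i = subst (λ t → target s t _ ≡ true) (≡.sym (f-side i)) (on-target i)
      g-injective : Injective _≡_ _≡_ g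
      g-injective {y} {y′} eq with v ≟ y | v ≟ y′
      ... | yes v≡y | yes v≡y′ = trans (≡.sym v≡y) v≡y′
      ... | yes _   | no v≢y′  = ⊥-elim (x∉image v≢y′ eq)
      ... | no v≢y  | yes _    = ⊥-elim (x∉image v≢y (≡.sym eq))
      ... | no v≢y  | no v≢y′  = punchOut-injective v≢y v≢y′ (f-injective
              (reduce-injective s (f _) (f _) eq (on-side-target _) (on-side-target _)))
      neighbour-in-Q : ∀ {y} (v≢y : v ≢ y) → adj F v y ≡ true → Q (reduce (f (punchOut v≢y))) ≡ true
      neighbour-in-Q v≢y v~y = target-opposite s _ _
        (λ same → proper _ _ v~y (≡.sym (trans (≡.sym (cong part (punchIn-punchOut v≢y))) same)))
        (on-target (punchOut v≢y))
      g-adj : ∀ y y′ → adj F y y′ ≡ true → adj G (g y) (g y′) ≡ true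
      g-adj y y′ y~y′ with v ≟ y | v ≟ y′
      ... | yes refl | yes refl with () ← trans (≡.sym y~y′) (irrefl F v)
      ... | yes refl | no v≢y′  = Q⊆N[x] _ (neighbour-in-Q v≢y′ y~y′)
      ... | no v≢y   | yes refl = trans (sym G _ x) (Q⊆N[x] _ (neighbour-in-Q v≢y (trans (sym F v y) y~y′)))
      ... | no v≢y   | no v≢y′  = edge-adj s (f _) (f _) (f-adj _ _
              (subst₂ (λ u w → adj F u w ≡ true)
                      (≡.sym (punchIn-punchOut v≢y)) (≡.sym (punchIn-punchOut v≢y′)) y~y′))

    bedges-between≤Z : ∀ z → IsZ n n (delete F v) (part ∘ punchIn v) z → ¬ Contains G F → bedges between ≤ z
    bedges-between≤Z z (_ , Z-max) G-free =
      subst (_≤ z) (bedges-oriented (part v)) (Z-max (oriented (part v)) (G-free ∘ extend))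

-- Decidability of containment and Zarankiewicz numbers

-- Functions are only compared pointwise (no function extensionality), hence the parameter _≈_.
Searchable : (A : Set) → (A → A → Set) → Set₁
Searchable A _≈_ = ∀ (P : A → Set) → (∀ a → Dec (P a)) → (∀ {a b} → a ≈ b → P a → P b) → Dec (Σ A P)

searchable-Fin : ∀ n → Searchable (Fin n) _≡_
searchable-Fin n P P? _ = any? P?

searchable-Bool : Searchable Bool _≡_
searchable-Bool P P? _ with P? true | P? false
... | yes p  | _      = yes (true , p)
... | no _   | yes q  = yes (false , q)
... | no ¬p  | no ¬q  = no λ { (true , p) → ¬p p ; (false , q) → ¬q q }

searchable-⊎ : ∀ {A B : Set} → Searchable A _≡_ → Searchable B _≡_ → Searchable (A ⊎ B) _≡_
searchable-⊎ search-A search-B P P? _ with search-A (P ∘ inj₁) (P? ∘ inj₁) (λ { refl p → p })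
... | yes (a , p) = yes (inj₁ a , p)
... | no ¬a with search-B (P ∘ inj₂) (P? ∘ inj₂) (λ { refl p → p })
...   | yes (b , p) = yes (inj₂ b , p)
...   | no ¬b       = no λ { (inj₁ a , p) → ¬a (a , p) ; (inj₂ b , p) → ¬b (b , p) }

searchable-→ : ∀ k {A : Set} {_≈_ : A → A → Set} → (∀ a → a ≈ a) → Searchable A _≈_ →
  Searchable (Fin k → A) (Pointwise _≈_)
searchable-→ zero    ≈-refl search P P? resp with P? (λ ())
... | yes p = yes ((λ ()) , p)
... | no ¬p = no λ { (f , pf) → ¬p (resp (λ ()) pf) }
searchable-→ (suc k) {A} {_≈_} ≈-refl search P P? resp with search Head Head? Head-resp
  where
  cons : A → (Fin k → A) → Fin (suc k) → A
  cons a f zero    = a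
  cons a f (suc i) = f i
  Head : A → Set
  Head a = Σ (Fin k → A) (P ∘ cons a)
  Head? : ∀ a → Dec (Head a)
  Head? a = searchable-→ k ≈-refl search (P ∘ cons a) (P? ∘ cons a)
              (λ f≈g → resp λ { zero → ≈-refl a ; (suc i) → f≈g i })
  Head-resp : ∀ {a b} → a ≈ b → Head a → Head b
  Head-resp a≈b (f , p) = f , resp (λ { zero → a≈b ; (suc i) → ≈-refl (f i) }) p
... | yes (a , f , p) = yes (_ , p)
... | no ¬head        = no λ { (f , p) →
  ¬head (f zero , f ∘ suc , resp (λ { zero → ≈-refl (f zero) ; (suc i) → ≈-refl (f (suc i)) }) p) }

injective? : ∀ {k} {A : Set} → DecidableEquality A → (f : Fin k → A) → Dec (Injective _≡_ _≡_ f)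
injective? _≟ᴬ_ f = map′ (λ inj {x} {y} → inj x y) (λ inj x y → inj)
  (all? λ x → all? λ y → (f x ≟ᴬ f y) →-dec (x ≟ y))

injective-resp : ∀ {k} {A : Set} {f g : Fin k → A} → f ≗ g → Injective _≡_ _≡_ f → Injective _≡_ _≡_ g
injective-resp f≗g f-inj {x} {y} gx≡gy = f-inj (trans (f≗g x) (trans gx≡gy (≡.sym (f≗g y))))

contains? : ∀ {n k} (G : Graph n) (F : Graph k) → Dec (Contains G F)
contains? {n} {k} G F = searchable-→ k (λ _ → refl) (searchable-Fin n) IsCopy IsCopy? resp
  where
  IsCopy : (Fin k → Fin n) → Set
  IsCopy f = Injective _≡_ _≡_ f × (∀ x y → adj F x y ≡ true → adj G (f x) (f y) ≡ true)
  IsCopy? : ∀ f → Dec (IsCopy f)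
  IsCopy? f = injective? _≟_ f ×-dec
              all? (λ x → all? λ y → (adj F x y Bool.≟ true) →-dec (adj G (f x) (f y) Bool.≟ true))
  resp : ∀ {f g} → f ≗ g → IsCopy f → IsCopy g
  resp f≗g (f-inj , f-adj) = injective-resp f≗g f-inj ,
    λ x y a → subst₂ (λ u w → adj G u w ≡ true) (f≗g x) (f≗g y) (f-adj x y a)

ordContains? : ∀ {m n k} (B : BGraph m n) (F : Graph k) (part : Bipartition k) → Dec (OrdContains B F part)
ordContains? {m} {n} {k} B F part =
  searchable-→ k (λ _ → refl) (searchable-⊎ (searchable-Fin m) (searchable-Fin n)) IsCopy IsCopy? resp
  where
  IsCopy : (Fin k → Fin m ⊎ Fin n) → Set
  IsCopy f = Injective _≡_ _≡_ f × (∀ x → side (f x) ≡ part x) ×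
             (∀ x y → adj F x y ≡ true → badj B (f x) (f y) ≡ true)
  IsCopy? : ∀ f → Dec (IsCopy f)
  IsCopy? f = injective? (Sum.≡-dec _≟_ _≟_) f ×-dec
              all? (λ x → side (f x) Bool.≟ part x) ×-dec
              all? (λ x → all? λ y → (adj F x y Bool.≟ true) →-dec (badj B (f x) (f y) Bool.≟ true))
  resp : ∀ {f g} → f ≗ g → IsCopy f → IsCopy g
  resp f≗g (f-inj , f-side , f-adj) = injective-resp f≗g f-inj ,
    (λ x → trans (cong side (≡.sym (f≗g x))) (f-side x)) ,
    (λ x y a → subst₂ (λ u w → badj B u w ≡ true) (f≗g x) (f≗g y) (f-adj x y a))

bounded-maximum : ∀ N (P : ℕ → Set) → (∀ t → Dec (P t)) → P 0 →
  ∃ λ t → P t × (∀ t′ → t′ ≤ N → P t′ → t′ ≤ t)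
bounded-maximum zero    P P? p0 = 0 , p0 , λ t′ t′≤0 _ → t′≤0
bounded-maximum (suc N) P P? p0 with P? (suc N)
... | yes p = suc N , p , λ t′ t′≤N _ → t′≤N
... | no ¬p with bounded-maximum N P P? p0
...   | t , pt , max = t , pt , max′
  where
  max′ : ∀ t′ → t′ ≤ suc N → P t′ → t′ ≤ t
  max′ t′ t′≤ pt′ with ℕ.m≤n⇒m<n∨m≡n t′≤
  ... | inj₁ t′<  = max t′ (ℕ.≤-pred t′<) pt′
  ... | inj₂ refl = ⊥-elim (¬p pt′)

badj-resp : ∀ {m n} {B C : BGraph m n} → (∀ a b → B a b ≡ C a b) → ∀ p q → badj B p q ≡ badj C p q
badj-resp B≡C (inj₁ a) (inj₁ b) = refl
badj-resp B≡C (inj₁ a) (inj₂ b) = B≡C a b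
badj-resp B≡C (inj₂ a) (inj₁ b) = B≡C b a
badj-resp B≡C (inj₂ a) (inj₂ b) = refl

-- The empty bipartite graph avoids F′ and bedges is bounded by m * n, so a maximum is attained.
Z-exists : ∀ m n {k} (F′ : Graph k) (part : Bipartition k) → HasEdge F′ → ∃ (IsZ m n F′ part)
Z-exists m n {k} F′ part (i₀ , j₀ , i₀~j₀)
  with bounded-maximum (m * n) Attained Attained? (empty , empty-free , bedges-empty m n)
  where
  Attained : ℕ → Set
  Attained t = Σ (BGraph m n) λ B → ¬ OrdContains B F′ part × bedges B ≡ t
  Attained? : ∀ t → Dec (Attained t)
  Attained? t = searchable-→ m (λ _ _ → refl) (searchable-→ n (λ _ → refl) searchable-Bool) _
    (λ B → ¬? (ordContains? B F′ part) ×-dec (bedges B ℕ.≟ t))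
    (λ B≈C (B-free , B-edges) →
      (λ { (f , f-inj , f-side , f-adj) →
           B-free (f , f-inj , f-side , λ x y a → trans (badj-resp (λ a b → B≈C a b) (f x) (f y)) (f-adj x y a)) }) ,
      trans (≡.sym (bedges-cong (λ a b → B≈C a b))) B-edges)
  empty : BGraph m n
  empty _ _ = false
  empty-free : ¬ OrdContains empty F′ part
  empty-free (f , _ , _ , f-adj) with f i₀ | f j₀ | f-adj i₀ j₀ i₀~j₀
  ... | inj₁ _ | inj₁ _ | ()
  ... | inj₁ _ | inj₂ _ | ()
  ... | inj₂ _ | inj₁ _ | ()
  ... | inj₂ _ | inj₂ _ | ()
... | t , (B , B-free , B-edges) , max =
  t , (B , B-free , B-edges) , λ C C-free → max (bedges C) (bedges≤ C) (C , C-free , refl)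

matching : ∀ n → BGraph n n
matching n a b = does (a ≟ b)

count-false : ∀ n → count {n} (λ _ → false) ≡ 0
count-false zero    = refl
count-false (suc n) = count-false n

count-matching-row : ∀ {n} (a : Fin n) → count (matching n a) ≡ 1
count-matching-row {suc n} zero    = cong suc (count-false n)
count-matching-row {suc n} (suc a) = count-matching-row a

bedges-matching : ∀ n → bedges (matching n) ≡ n
bedges-matching n = trans (sumFin-cong {n} count-matching-row) (trans (sumFin-const n 1) (ℕ.*-identityʳ n))

does-≟-true : ∀ {n} (a b : Fin n) → does (a ≟ b) ≡ true → a ≡ b
does-≟-true a b _ with a ≟ b
... | yes a≡b = a≡b

matching-unique-neighbour : ∀ {n} (u p q : Fin n ⊎ Fin n) →
  badj (matching n) u p ≡ true → badj (matching n) u q ≡ true → p ≡ q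
matching-unique-neighbour (inj₁ a) (inj₂ b) (inj₂ c) a≡b a≡c =
  cong inj₂ (trans (≡.sym (does-≟-true a b a≡b)) (does-≟-true a c a≡c))
matching-unique-neighbour (inj₂ a) (inj₁ b) (inj₁ c) b≡a c≡a =
  cong inj₁ (trans (does-≟-true b a b≡a) (≡.sym (does-≟-true c a c≡a)))

cherry⇒n≤Z : ∀ {n k} (F : Graph k) (part : Bipartition k) {z} → Cherry F → IsZ n n F part z → n ≤ z
cherry⇒n≤Z {n} F part (w , p , q , p≢q , w~p , w~q) (_ , Z-max) =
  subst (_≤ _) (bedges-matching n) (Z-max (matching n) λ (f , f-injective , _ , f-adj) →
    p≢q (f-injective (matching-unique-neighbour (f w) (f p) (f q) (f-adj w p w~p) (f-adj w q w~q))))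

-- The counting argument

block : ∀ {n} → BGraph n n → (Fin n → Bool) → (Fin n → Bool) → BGraph n n
block B p q u w = B u w ∧ (p u ∧ q w)

bedges-blocks : ∀ {n} (B : BGraph n n) (p : Fin n → Bool) → bedges B ≡
  (bedges (block B p p) + bedges (block B p (not ∘ p))) +
  (bedges (block B (not ∘ p) p) + bedges (block B (not ∘ p) (not ∘ p)))
bedges-blocks B p = trans (bedges-split B (λ u _ → p u)) (cong₂ _+_
  (trans (bedges-split (λ u w → B u w ∧ p u) (λ _ w → p w))
         (cong₂ _+_ (bedges-cong (λ u w → ∧-assoc (B u w) (p u) (p w)))
                    (bedges-cong (λ u w → ∧-assoc (B u w) (p u) (not (p w))))))
  (trans (bedges-split (λ u w → B u w ∧ not (p u)) (λ _ w → p w))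
         (cong₂ _+_ (bedges-cong (λ u w → ∧-assoc (B u w) (not (p u)) (p w)))
                    (bedges-cong (λ u w → ∧-assoc (B u w) (not (p u)) (not (p w)))))))

bedges-block-transpose : ∀ {n} (G : Graph n) (p q : Fin n → Bool) →
  bedges (block (adj G) p q) ≡ bedges (block (adj G) q p)
bedges-block-transpose G p q = trans (bedges-transpose (block (adj G) p q))
  (bedges-cong (λ w u → cong₂ _∧_ (sym G u w) (∧-comm (p u) (q w))))

bedges-row : ∀ {n} (x : Fin n) → bedges {n} {n} (λ u _ → matching n x u) ≡ n
bedges-row {n} x = trans (bedges-transpose {n} {n} (λ u _ → matching n x u))
  (trans (sumFin-cong {n} (λ _ → count-matching-row x)) (trans (sumFin-const n 1) (ℕ.*-identityʳ n)))

ex-bound : ∀ {k n n′} {F : Graph k} {e} → n′ ≡ n → IsEx n F e → (D : Graph n′) → ¬ Contains D F → edges D ≤ e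
ex-bound refl (_ , ex-max) = ex-max

+-self-injective : ∀ {a b} → a + a ≡ b + b → a ≡ b
+-self-injective {a} {b} eq = trans (ℕ.n≡⌊n+n/2⌋ a) (trans (cong ⌊_/2⌋ eq) (≡.sym (ℕ.n≡⌊n+n/2⌋ b)))

module EdgeCount {k} (F : Graph (suc k)) (part : Bipartition (suc k)) (proper : Proper F part) (v : Fin (suc k))
  (connected : Connected (delete F v)) (cherry : Cherry (delete F v))
  {n} (G : Graph n) (G-free : ¬ Contains G F) {z e : ℕ}
  (isZ : IsZ n n (delete F v) (part ∘ punchIn v) z) (isEx : IsEx n F e) (x : Fin n) where

  N R : Fin n → Bool
  N = adj G x
  R = not ∘ N

  block≤Z : (P Q : Fin n → Bool) → (∀ u → P u ≡ true → Q u ≡ true → ⊥) → P x ≡ false → Q x ≡ false →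
    (∀ u → Q u ≡ true → N u ≡ true) → bedges (block (adj G) P Q) ≤ z
  block≤Z P Q disjoint x∉P x∉Q Q⊆N = Apex.bedges-between≤Z G x P Q disjoint x∉P x∉Q Q⊆N
    F part proper v (let (_ , _ , _ , p≢q , _) = cherry in connected⇒no-isolated (delete F v) connected p≢q) z isZ G-free

  block-sym : ∀ u w → block (adj G) N N u w ≡ block (adj G) N N w u
  block-sym u w = cong₂ _∧_ (sym G u w) (∧-comm (N u) (N w))

  neighbours-block≤ : bedges (block (adj G) N N) ≤ 2 * (z + z)
  neighbours-block≤ with max-cut (block (adj G) N N) block-sym (λ u → cong (_∧ (N u ∧ N u)) (irrefl G u))
  ... | s , cut-large = begin
    bedges (block (adj G) N N)                          ≤⟨ cut-large ⟩
    2 * bedges (cut (block (adj G) N N) s)              ≡⟨ cong (2 *_) (cut≡directed-cut+directed-cut _ s block-sym) ⟩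
    2 * (bedges directed + bedges directed)             ≤⟨ *-monoʳ-≤ 2 (+-mono-≤ directed≤ directed≤) ⟩
    2 * (z + z)                                         ∎
    where
    open ℕ.≤-Reasoning
    directed : BGraph n n
    directed u w = block (adj G) N N u w ∧ (s u ∧ not (s w))
    regroup : ∀ a b c d e → (a ∧ (b ∧ c)) ∧ (d ∧ e) ≡ a ∧ ((b ∧ d) ∧ (c ∧ e))
    regroup a b c d e = trans (∧-assoc a (b ∧ c) (d ∧ e)) (cong (a ∧_) (∧-interchange b c d e))
    directed≤ : bedges directed ≤ z
    directed≤ = subst (_≤ z) (bedges-cong (λ u w → ≡.sym (regroup (adj G u w) (N u) (N w) (s u) (not (s w)))))
      (block≤Z (λ u → N u ∧ s u) (λ u → N u ∧ not (s u))
        (λ u in-s in-¬s → not-both (∧-true-right {N u} in-s) (∧-true-right {N u} in-¬s))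
        (cong (_∧ s x) (irrefl G x)) (cong (_∧ not (s x)) (irrefl G x)) (λ u → ∧-true-left))

  -- The row of x contributes at most n; the remaining non-neighbours lie in a graph with apex x.
  non-neighbours-neighbours-block≤ : bedges (block (adj G) R N) ≤ n + z
  non-neighbours-neighbours-block≤ = begin
    bedges (block (adj G) R N)
      ≡⟨ bedges-split (block (adj G) R N) (λ u _ → is-x u) ⟩
    bedges (λ u w → block (adj G) R N u w ∧ is-x u) + bedges (λ u w → block (adj G) R N u w ∧ not (is-x u))
      ≤⟨ +-mono-≤ (bedges-mono (λ u w → ∧-true-right {block (adj G) R N u w})) ≤-refl ⟩
    bedges {n} {n} (λ u _ → is-x u) + bedges (λ u w → block (adj G) R N u w ∧ not (is-x u))
      ≡⟨ cong₂ _+_ (bedges-row x) (bedges-cong (λ u w → regroup (adj G u w) (R u) (N w) (not (is-x u)))) ⟩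
    n + bedges (block (adj G) (λ u → R u ∧ not (is-x u)) N)
      ≤⟨ +-mono-≤ (≤-refl {n}) (block≤Z (λ u → R u ∧ not (is-x u)) N
           (λ u in-P in-N → not-both in-N (∧-true-left in-P))
           (trans (cong (λ b → R x ∧ not b) (dec-true (x ≟ x) refl)) (∧-zeroʳ (R x)))
           (irrefl G x) (λ _ in-N → in-N)) ⟩
    n + z ∎
    where
    open ℕ.≤-Reasoning
    is-x : Fin n → Bool
    is-x = matching n x
    regroup : ∀ a b c d → (a ∧ (b ∧ c)) ∧ d ≡ a ∧ ((b ∧ d) ∧ c)
    regroup a b c d = trans (∧-assoc a (b ∧ c) d) (cong (a ∧_) (xy∙z≈xz∙y b c d))

  module _ (few : count R + count R ≤ n) (a₀ : Fin n) (a₀∈N : N a₀ ≡ true) where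

    open Doubling G R a₀ (cong not a₀∈N) (n ∸ (count R + count R))

    order-doubled : count R + (count R + (n ∸ (count R + count R))) ≡ n
    order-doubled = trans (≡.sym (ℕ.+-assoc (count R) (count R) _)) (ℕ.m+[n∸m]≡n few)

    non-neighbours-block≤ : bedges (block (adj G) R R) ≤ e
    non-neighbours-block≤ = subst (_≤ e)
      (+-self-injective (trans (edges+edges≡bedges doubled) bedges-doubled))
      (ex-bound {F = F} order-doubled isEx doubled (G-free ∘ contains-doubled⇒contains F v connected
                                                       (let (w , p , _ , _ , w~p , _) = cherry in w , p , w~p)))

    edges+edges≤ : edges G + edges G ≤ (2 * (z + z) + (n + z)) + ((n + z) + e)
    edges+edges≤ = begin
      edges G + edges G
        ≡⟨ edges+edges≡bedges G ⟩
      bedges (adj G)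
        ≡⟨ bedges-blocks (adj G) N ⟩
      (bedges (block (adj G) N N) + bedges (block (adj G) N R)) + (bedges (block (adj G) R N) + bedges (block (adj G) R R))
        ≡⟨ cong (λ t → (bedges (block (adj G) N N) + t) + (bedges (block (adj G) R N) + bedges (block (adj G) R R)))
                (bedges-block-transpose G N R) ⟩
      (bedges (block (adj G) N N) + bedges (block (adj G) R N)) + (bedges (block (adj G) R N) + bedges (block (adj G) R R))
        ≤⟨ +-mono-≤ (+-mono-≤ neighbours-block≤ non-neighbours-neighbours-block≤)
                    (+-mono-≤ non-neighbours-neighbours-block≤ non-neighbours-block≤) ⟩
      (2 * (z + z) + (n + z)) + ((n + z) + e) ∎
      where open ℕ.≤-Reasoning

-- Arithmetic of the constants

toℚ≡mkℚ : ∀ t → toℚ t ≡ mkℚ (ℤ.+ t) 0 (Coprimality.sym (1-coprimeTo t))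
toℚ≡mkℚ t = ℚ.normalize-coprime (Coprimality.sym (1-coprimeTo t))

fraction*toℚ≤toℚ⇒ : ∀ a b .(c : Coprime a (suc b)) t s →
  mkℚ (ℤ.+ a) b c ℚ.* toℚ t ℚ.≤ toℚ s → a * t ≤ s * suc b
fraction*toℚ≤toℚ⇒ a b c t s h with ℚ.toℚᵘ-mono-≤ h
... | h′ rewrite toℚ≡mkℚ t | toℚ≡mkℚ s
  with ℚᵘ.≤-respˡ-≃ (ℚ.toℚᵘ-homo-* (mkℚ (ℤ.+ a) b c) (mkℚ (ℤ.+ t) 0 (Coprimality.sym (1-coprimeTo t)))) h′
... | *≤* k rewrite ℤ.+◃n≡+n (a * t) | ℤ.*-identityʳ (ℤ.+ (a * t)) | ≡.sym (ℤ.pos-* s (suc (b * 1)))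
                  | ℕ.*-identityʳ b = ℤ.drop‿+≤+ k

toℚ<fraction*toℚ⇒ : ∀ a b .(c : Coprime a (suc b)) t s →
  toℚ s ℚ.< mkℚ (ℤ.+ a) b c ℚ.* toℚ t → s * suc b < a * t
toℚ<fraction*toℚ⇒ a b c t s h with ℚ.toℚᵘ-mono-< h
... | h′ rewrite toℚ≡mkℚ t | toℚ≡mkℚ s
  with ℚᵘ.<-respʳ-≃ (ℚ.toℚᵘ-homo-* (mkℚ (ℤ.+ a) b c) (mkℚ (ℤ.+ t) 0 (Coprimality.sym (1-coprimeTo t)))) h′
... | *<* k rewrite ℤ.+◃n≡+n (a * t) | ℤ.*-identityʳ (ℤ.+ (a * t)) | ≡.sym (ℤ.pos-* s (suc (b * 1)))
                  | ℕ.*-identityʳ b = ℤ.drop‿+<+ k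

α₀ β₀ ε₀ : ℚ
α₀ = ℤ.+ 2 ℚ./ 3
β₀ = ℤ.+ 1 ℚ./ 4
ε₀ = ℤ.+ 1 ℚ./ 16

0<α₀ : 0ℚ ℚ.< α₀
0<α₀ = ℚ.*<* (ℤ.+<+ (s≤s z≤n))

α₀<1 : α₀ ℚ.< 1ℚ
α₀<1 = ℚ.*<* (ℤ.+<+ (s≤s (s≤s (s≤s z≤n))))

0<β₀ : 0ℚ ℚ.< β₀
0<β₀ = ℚ.*<* (ℤ.+<+ (s≤s z≤n))

β₀<1 : β₀ ℚ.< 1ℚ
β₀<1 = ℚ.*<* (ℤ.+<+ (s≤s (s≤s z≤n)))

0<ε₀ : 0ℚ ℚ.< ε₀
0<ε₀ = ℚ.*<* (ℤ.+<+ (s≤s z≤n))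

α₀*toℚ≤toℚ⇒ : ∀ t s → α₀ ℚ.* toℚ t ℚ.≤ toℚ s → 2 * t ≤ s * 3
α₀*toℚ≤toℚ⇒ = fraction*toℚ≤toℚ⇒ 2 2 _

[1-β₀]*toℚ≤toℚ⇒ : ∀ t s → (1ℚ ℚ.- β₀) ℚ.* toℚ t ℚ.≤ toℚ s → 3 * t ≤ s * 4
[1-β₀]*toℚ≤toℚ⇒ = fraction*toℚ≤toℚ⇒ 3 3 _

toℚ<ε₀*toℚ⇒ : ∀ t s → toℚ s ℚ.< ε₀ ℚ.* toℚ t → s * 16 < 1 * t
toℚ<ε₀*toℚ⇒ = toℚ<fraction*toℚ⇒ 1 15 _

non-neighbours≤neighbours : ∀ n d m → d + m ≡ n → 2 * (n ∸ 1) ≤ d * 3 → 4 ≤ n → m ≤ d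
non-neighbours≤neighbours (suc n′) d m d+m≡n 2n′≤3d (s≤s 3≤n′) =
  ℕ.*-cancelʳ-≤ m d 3 (ℕ.+-cancelʳ-≤ (d * 3) (m * 3) (d * 3) (begin
    m * 3 + d * 3      ≡⟨ solve 2 (λ d m → m :* con 3 :+ d :* con 3 := (d :+ m) :* con 3) refl d m ⟩
    (d + m) * 3        ≡⟨ cong (_* 3) d+m≡n ⟩
    3 + n′ * 3         ≤⟨ +-monoˡ-≤ (n′ * 3) 3≤n′ ⟩
    n′ + n′ * 3        ≡⟨ solve 1 (λ n′ → n′ :+ n′ :* con 3 := con 2 :* (con 2 :* n′)) refl n′ ⟩
    2 * (2 * n′)       ≤⟨ *-monoʳ-≤ 2 2n′≤3d ⟩
    2 * (d * 3)        ≡⟨ solve 1 (λ d → con 2 :* (d :* con 3) := d :* con 3 :+ d :* con 3) refl d ⟩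
    d * 3 + d * 3      ∎))
  where open ℕ.≤-Reasoning

positive-degree : ∀ n d → 2 * (n ∸ 1) ≤ d * 3 → 4 ≤ n → 1 ≤ d
positive-degree (suc n′) zero    2n′≤0 (s≤s 3≤n′) with () ← ℕ.≤-trans (*-monoʳ-≤ 2 3≤n′) 2n′≤0
positive-degree n        (suc d) _     _          = s≤s z≤n

-- 3e ≤ 4E = 2(E + E) ≤ 2e + 16z forces e ≤ 16z.
edge-count-contradiction : ∀ E e n z → E + E ≤ (2 * (z + z) + (n + z)) + ((n + z) + e) → n ≤ z →
  3 * e ≤ E * 4 → z * 16 < 1 * e → ⊥
edge-count-contradiction E e n z E+E≤ n≤z 3e≤4E 16z<e = ℕ.<-irrefl refl (ℕ.<-≤-trans 16z<e (begin
  1 * e   ≤⟨ ℕ.+-cancelʳ-≤ (e + e) (1 * e) (z * 16) (begin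
    1 * e + (e + e)        ≡⟨ solve 1 (λ e → con 1 :* e :+ (e :+ e) := con 3 :* e) refl e ⟩
    3 * e                  ≤⟨ 3e≤4E ⟩
    E * 4                  ≡⟨ solve 1 (λ E → E :* con 4 := con 2 :* (E :+ E)) refl E ⟩
    2 * (E + E)            ≤⟨ *-monoʳ-≤ 2 E+E≤ ⟩
    2 * ((2 * (z + z) + (n + z)) + ((n + z) + e))
                           ≤⟨ *-monoʳ-≤ 2 (+-mono-≤ (+-monoʳ-≤ (2 * (z + z)) n+z≤) (+-monoˡ-≤ e n+z≤)) ⟩
    2 * ((2 * (z + z) + (z + z)) + ((z + z) + e))
                           ≡⟨ solve 2 (λ e z → con 2 :* ((con 2 :* (z :+ z) :+ (z :+ z)) :+ ((z :+ z) :+ e))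
                                               := z :* con 16 :+ (e :+ e)) refl e z ⟩
    z * 16 + (e + e)       ∎) ⟩
  z * 16  ∎))
  where
  open ℕ.≤-Reasoning
  n+z≤ : n + z ≤ z + z
  n+z≤ = +-monoˡ-≤ z n≤z

-- Dense F-free graphs of large maximum degree

high-degree-vertex : ∀ {n} (G : Graph n) → 4 ≤ n → 2 * (n ∸ 1) ≤ maxDegree G * 3 →
  ∃ λ x → count (not ∘ adj G x) + count (not ∘ adj G x) ≤ n × ∃ λ a₀ → adj G x a₀ ≡ true
high-degree-vertex {n} G 4≤n Δ-large with maxDegree-attained G (Fin.fromℕ< 4≤n)
... | x , degree≡Δ = x , few , count-positive (adj G x) (positive-degree n (degree G x) Δ-large′ 4≤n)
  where
  m = count (not ∘ adj G x)
  Δ-large′ : 2 * (n ∸ 1) ≤ degree G x * 3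
  Δ-large′ = subst (λ t → 2 * (n ∸ 1) ≤ t * 3) (≡.sym degree≡Δ) Δ-large
  few : m + m ≤ n
  few = ℕ.≤-trans
    (+-monoˡ-≤ m (non-neighbours≤neighbours n (degree G x) m (count-complement (adj G x)) Δ-large′ 4≤n))
    (ℕ.≤-reflexive (count-complement (adj G x)))

module _ {k} (F : Graph (suc k)) (part : Bipartition (suc k)) (proper : Proper F part) (v : Fin (suc k))
  (connected : Connected (delete F v)) (cherry : Cherry (delete F v)) where

  no-dense-F-free-graph : ∀ {n} (G : Graph n) → ¬ Contains G F → 4 ≤ n → 2 * (n ∸ 1) ≤ maxDegree G * 3 →
    ∀ {z e} → IsZ n n (delete F v) (part ∘ punchIn v) z → IsEx n F e →
    3 * e ≤ edges G * 4 → z * 16 < 1 * e → ⊥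
  no-dense-F-free-graph {n} G G-free 4≤n Δ-large {z} {e} isZ isEx dense Z-small
    with high-degree-vertex G 4≤n Δ-large
  ... | x , few , a₀ , x~a₀ = edge-count-contradiction (edges G) e n z
    (EdgeCount.edges+edges≤ F part proper v connected cherry G G-free isZ isEx x few a₀ x~a₀)
    (cherry⇒n≤Z (delete F v) (part ∘ punchIn v) cherry isZ) dense Z-small

  sparse-Z⇒bounded-with :
    (∀ (ε : ℚ) → 0ℚ ℚ.< ε → ∃[ N ] ∀ n → N ≤ n → ∀ z e →
       IsZ n n (delete F v) (part ∘ punchIn v) z → IsEx n F e → toℚ z ℚ.< ε ℚ.* toℚ e) →
    BoundedWith α₀ β₀ F
  sparse-Z⇒bounded-with Z-sparse with Z-sparse ε₀ 0<ε₀
  ... | N , Z-small = N + 4 , bounded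
    where
    bounded : ∀ n → N + 4 ≤ n → ∀ (G : Graph n) → α₀ ℚ.* toℚ (n ∸ 1) ℚ.≤ toℚ (maxDegree G) →
      ∀ e → IsEx n F e → (1ℚ ℚ.- β₀) ℚ.* toℚ e ℚ.≤ toℚ (edges G) → Contains G F
    bounded n N+4≤n G Δ-large e isEx dense with contains? G F
    ... | yes copy   = copy
    ... | no  G-free with Z-exists n n (delete F v) (part ∘ punchIn v) (let (w , p , _ , _ , w~p , _) = cherry in w , p , w~p)
    ...   | z , isZ = ⊥-elim (no-dense-F-free-graph G G-free (ℕ.m+n≤o⇒n≤o N N+4≤n)
                        (α₀*toℚ≤toℚ⇒ (n ∸ 1) (maxDegree G) Δ-large) isZ isEx
                        ([1-β₀]*toℚ≤toℚ⇒ e (edges G) dense)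
                        (toℚ<ε₀*toℚ⇒ e z (Z-small n (ℕ.m+n≤o⇒m≤o N N+4≤n) z e isZ isEx)))

-- Bipartiteness is already witnessed by the proper bipartition that comes with criticality.
theorem1p3 : ∀ {k} (F : Graph (suc k)) → IsBipartite F → HasCycle F →
    (v : Fin (suc k)) → Critical F v → Connected (delete F v) → Bounded F
theorem1p3 F _ cycle v (part , proper , Z-sparse) connected =
  α₀ , β₀ , 0<α₀ , α₀<1 , 0<β₀ , β₀<1 , sparse-Z⇒bounded-with F part proper v connected cherry Z-sparse
  where
  cherry : Cherry (delete F v)
  cherry = connected⇒cherry (delete F v) (ℕ.≤-pred (proper-cycle⇒4≤order F part proper cycle)) connected
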